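{- Let $\mathbf{s}=(s_1,\dots,s_n)$ be a sequence of positive integers. Then $\operatorname{REM}_{\mathbf{s}}$ is a bijection from $\operatorname{Par}_{\mathbf{s}}\cap\mathbb{Z}^n$ to $\Psi_n$.
   Context: $\langle N\rangle=\{0,\dots,N\}$, $\Psi_n=\langle s_1-1\rangle\times\cdots\times\langle s_n-1\rangle$. $\operatorname{Par}_{\mathbf{s}}=\{\sum_{j=1}^n c_j\mathbf{w}_j: 0\le c_j<1\}$ with $\mathbf{w}_j=(0,\dots,0,s_j,\dots,s_n)$ ($j-1$ leading zeros). For $\mathbf{x}\in\operatorname{Par}_{\mathbf{s}}\cap\mathbb{Z}^n$, $\operatorname{REM}_{\mathbf{s}}(\mathbf{x})=(r_1,\dots,r_n)$ where $r_i$ is the remainder of $x_i$ upon division by $s_i$ (so $x_i=\lfloor x_i/s_i\rfloor s_i+r_i$, $r_i\in\langle s_i-1\rangle$).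
   Formalization: The coefficients $c_j$ in the definition of $\operatorname{Par}_{\mathbf{s}}$ range over the rationals in [0,1). -}

module Defs where

open import Data.Nat as ℕ using (ℕ; NonZero)
open import Data.Integer as ℤ using (ℤ; +_; _%ℕ_)
open import Data.Fin using (Fin; zero; suc; _≤_)
open import Data.Rational using (ℚ; _/_; 0ℚ; _+_; _*_)
open import Relation.Nullary using (yes; no)
open import Relation.Binary.PropositionalEquality using (_≡_)
open import Data.Product using (Σ; _×_)
import Data.Rational as Q
import Data.Fin.Properties as FinP

sumFin : ∀ {n} → (Fin n → ℚ) → ℚ
sumFin {ℕ.zero}  f = 0ℚ
sumFin {ℕ.suc n} f = f zero + sumFin (λ j → f (suc j))

ℤtoℚ : ℤ → ℚ
ℤtoℚ x = x / 1

ℕtoℚ : ℕ → ℚ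
ℕtoℚ m = (+ m) / 1

-- w_j = (0,…,0,s_j,…,s_n) : the i-th coordinate of w_j is s_i if j ≤ i, else 0
w : ∀ {n} → (Fin n → ℕ) → Fin n → Fin n → ℚ
w s j i with j FinP.≤? i
... | yes _ = ℕtoℚ (s i)
... | no  _ = 0ℚ

InPar : ∀ {n} → (Fin n → ℕ) → (Fin n → ℤ) → Set
InPar {n} s x =
  Σ (Fin n → ℚ) λ c →
    ((j : Fin n) → (0ℚ Q.≤ c j) × (c j Q.< Q.1ℚ)) ×
    ((i : Fin n) → ℤtoℚ (x i) ≡ sumFin (λ j → c j * w s j i))

REM : ∀ {n} (s : Fin n → ℕ) → ((i : Fin n) → NonZero (s i)) →
      (Fin n → ℤ) → Fin n → ℕ
REM s pos x i = _%ℕ_ (x i) (s i) {{pos i}}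

InΨ : ∀ {n} → (Fin n → ℕ) → (Fin n → ℕ) → Set
InΨ s r = (i : Fin _) → r i ℕ.< s i

module Submission where

-- For coefficients c ∈ [0,1)ⁿ the i-th coordinate of Σ_j c_j w_j is
-- s_i · (c_1 + ⋯ + c_i).  We therefore work with the translates a·s + Par_s
-- (ParFrom a s), which unfold one coordinate at a time: x lies in a·s + Par_s
-- iff x_1 = (a + c_1)·s_1 for some c_1 ∈ [0,1) and the tail of x lies in
-- (a + c_1)·s' + Par_{s'}, s' the tail of s (ParFrom-uncons, ParFrom-cons).
-- The whole theorem thus reduces to one coordinate: for a rational offset a
-- and S > 0, every residue class modulo S has exactly one integer X with
-- X = (a + c)·S for some c ∈ [0,1), i.e. in the window [a·S, a·S + S).
--   * uniqueness (step-injective): two such integers differ by a multiple of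
--     S of absolute value < S, hence coincide;
--   * existence (step-exists): writing a = p/q, take X = r − t·S where
--     t = (r·q − p·S) div (S·q); then q·X = p·S + ((r·q − p·S) mod S·q).
-- Induction on n gives injectivity and surjectivity on every translate;
-- the theorem is the case a = 0, together with the bound on remainders.
-- The arithmetic is transported between ℤ and ℚ by the embedding ℤtoℚ.

open import Defs
open import Data.Nat using (ℕ; NonZero)
open import Data.Integer using (ℤ)
open import Data.Fin using (Fin)
open import Data.Product using (Σ; _×_)
open import Relation.Binary.PropositionalEquality using (_≡_)

open import Data.Nat as ℕ using (zero; suc)
import Data.Nat.Properties as ℕP
open import Data.Fin using (zero; suc)
import Data.Fin.Properties as FinP
open import Data.Integer as ℤ using (+_; -[1+_]; +[1+_]; +0; 0ℤ; _%ℕ_; _/ℕ_)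
import Data.Integer.Properties as ℤP
import Data.Integer.DivMod as ℤD
import Data.Integer.Solver as ℤSolver
open import Data.Rational as Q using (ℚ; 0ℚ; 1ℚ; ↥_; ↧_; ↧ₙ_; _/_; _+_; _*_; _-_; -_; 1/_; _≤_; _<_)
open import Data.Rational.Literals using (fromℤ)
import Data.Rational.Properties as QP
import Data.Rational.Solver as ℚSolver
import Data.Rational.Unnormalised as ℚᵘ
import Data.Rational.Unnormalised.Properties as ℚᵘP
open import Data.Product using (_,_; proj₁; proj₂)
open import Data.Vec.Functional using (_∷_; tail)
open import Data.Empty using (⊥-elim)
open import Function using (_∘_)
open import Relation.Nullary using (yes; no; contradiction)
open import Relation.Binary.PropositionalEquality
  using (refl; sym; trans; cong; cong₂; subst; subst₂; module ≡-Reasoning)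

open ≡-Reasoning

-- The embedding ℤ → ℚ.  ℤtoℚ z = z / 1 agrees with the literal fromℤ z,
-- on which + and * compute; this transfers the ring operations and the order.

ℤtoℚ≡fromℤ : ∀ z → ℤtoℚ z ≡ fromℤ z
ℤtoℚ≡fromℤ z = QP.↥p/↧p≡p (fromℤ z)

ℤtoℚ-+ : ∀ a b → ℤtoℚ (a ℤ.+ b) ≡ ℤtoℚ a + ℤtoℚ b
ℤtoℚ-+ a b = trans
  (cong (_/ 1) (sym (cong₂ ℤ._+_ (ℤP.*-identityʳ a) (ℤP.*-identityʳ b))))
  (sym (cong₂ _+_ (ℤtoℚ≡fromℤ a) (ℤtoℚ≡fromℤ b)))

ℤtoℚ-* : ∀ a b → ℤtoℚ (a ℤ.* b) ≡ ℤtoℚ a * ℤtoℚ b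
ℤtoℚ-* a b = sym (cong₂ _*_ (ℤtoℚ≡fromℤ a) (ℤtoℚ≡fromℤ b))

ℤtoℚ-neg : ∀ z → ℤtoℚ (ℤ.- z) ≡ - ℤtoℚ z
ℤtoℚ-neg z = trans (ℤtoℚ≡fromℤ (ℤ.- z))
  (trans (sym (neg-fromℤ z)) (cong -_ (sym (ℤtoℚ≡fromℤ z))))
  where
  neg-fromℤ : ∀ z → - fromℤ z ≡ fromℤ (ℤ.- z)
  neg-fromℤ +0       = refl
  neg-fromℤ +[1+ n ] = refl
  neg-fromℤ -[1+ n ] = refl

ℤtoℚ-- : ∀ a b → ℤtoℚ (a ℤ.- b) ≡ ℤtoℚ a - ℤtoℚ b
ℤtoℚ-- a b = trans (ℤtoℚ-+ a (ℤ.- b)) (cong (λ v → ℤtoℚ a + v) (ℤtoℚ-neg b))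

ℤtoℚ-mono-≤ : ∀ {a b} → a ℤ.≤ b → ℤtoℚ a ≤ ℤtoℚ b
ℤtoℚ-mono-≤ {a} {b} a≤b = subst₂ _≤_ (sym (ℤtoℚ≡fromℤ a)) (sym (ℤtoℚ≡fromℤ b))
  (Q.*≤* (subst₂ ℤ._≤_ (sym (ℤP.*-identityʳ a)) (sym (ℤP.*-identityʳ b)) a≤b))

ℤtoℚ-mono-< : ∀ {a b} → a ℤ.< b → ℤtoℚ a < ℤtoℚ b
ℤtoℚ-mono-< {a} {b} a<b = subst₂ _<_ (sym (ℤtoℚ≡fromℤ a)) (sym (ℤtoℚ≡fromℤ b))
  (Q.*<* (subst₂ ℤ._<_ (sym (ℤP.*-identityʳ a)) (sym (ℤP.*-identityʳ b)) a<b))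

ℤtoℚ-cancel-< : ∀ {a b} → ℤtoℚ a < ℤtoℚ b → a ℤ.< b
ℤtoℚ-cancel-< {a} {b} a<b with subst₂ _<_ (ℤtoℚ≡fromℤ a) (ℤtoℚ≡fromℤ b) a<b
... | Q.*<* a*1<b*1 = subst₂ ℤ._<_ (ℤP.*-identityʳ a) (ℤP.*-identityʳ b) a*1<b*1

ℕtoℚ-positive : ∀ m .{{_ : NonZero m}} → Q.Positive (ℕtoℚ m)
ℕtoℚ-positive (suc k) = subst Q.Positive (sym (ℤtoℚ≡fromℤ (+ suc k))) _

fraction-form : ∀ a → a * ℕtoℚ (↧ₙ a) ≡ ℤtoℚ (↥ a)
fraction-form a@record{} = begin
  a * ℕtoℚ (↧ₙ a)    ≡⟨ cong (a *_) (ℤtoℚ≡fromℤ (+ ↧ₙ a)) ⟩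
  a * fromℤ (+ ↧ₙ a) ≡⟨ QP.toℚᵘ-injective
                          (ℚᵘP.≃-trans (QP.toℚᵘ-homo-* a (fromℤ (+ ↧ₙ a)))
                                       (ℚᵘ.*≡* (ℤP.*-assoc (↥ a) (↧ a) (+ 1)))) ⟩
  fromℤ (↥ a)        ≡⟨ sym (ℤtoℚ≡fromℤ (↥ a)) ⟩
  ℤtoℚ (↥ a)         ∎

multiple-in-window : ∀ S .{{_ : NonZero S}} k →
  ℤ.- (+ S) ℤ.< k ℤ.* + S → k ℤ.* + S ℤ.< + S → k ≡ 0ℤ
multiple-in-window S +0 _ _ = refl
multiple-in-window S +[1+ m ] _ kS<S = contradiction kS<S (ℤP.≤⇒≯ S≤kS)
  where
  S≤kS : + S ℤ.≤ +[1+ m ] ℤ.* + S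
  S≤kS = subst (ℤ._≤ +[1+ m ] ℤ.* + S) (ℤP.*-identityˡ (+ S))
    (ℤP.*-monoʳ-≤-nonNeg (+ S) (ℤ.+≤+ {1} {suc m} (ℕ.s≤s ℕ.z≤n)))
multiple-in-window S -[1+ m ] -S<kS _ = contradiction -S<kS (ℤP.≤⇒≯ kS≤-S)
  where
  kS≤-S : -[1+ m ] ℤ.* + S ℤ.≤ ℤ.- (+ S)
  kS≤-S = subst (-[1+ m ] ℤ.* + S ℤ.≤_) (ℤP.-1*i≡-i (+ S))
    (ℤP.*-monoʳ-≤-nonNeg (+ S) (ℤ.-≤- {m} {0} ℕ.z≤n))

close-congruent⇒≡ : ∀ S .{{_ : NonZero S}} x y k → x ℤ.- y ≡ k ℤ.* + S →
  ℤ.- (+ S) ℤ.< x ℤ.- y → x ℤ.- y ℤ.< + S → x ≡ y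
close-congruent⇒≡ S x y k x-y≡kS lower upper = ℤP.i-j≡0⇒i≡j x y (begin
  x ℤ.- y   ≡⟨ x-y≡kS ⟩
  k ℤ.* + S ≡⟨ cong (ℤ._* + S) k≡0 ⟩
  0ℤ ℤ.* + S ≡⟨ ℤP.*-zeroˡ (+ S) ⟩
  0ℤ        ∎)
  where
  k≡0 : k ≡ 0ℤ
  k≡0 = multiple-in-window S k (subst (ℤ.- (+ S) ℤ.<_) x-y≡kS lower)
                               (subst (ℤ._< + S) x-y≡kS upper)

same-remainder⇒multiple : ∀ S .{{_ : NonZero S}} x y → x %ℕ S ≡ y %ℕ S →
  x ℤ.- y ≡ (x /ℕ S ℤ.- y /ℕ S) ℤ.* + S
same-remainder⇒multiple S x y rem = begin
  x ℤ.- y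
    ≡⟨ cong₂ ℤ._-_ (ℤD.a≡a%ℕn+[a/ℕn]*n x S) (ℤD.a≡a%ℕn+[a/ℕn]*n y S) ⟩
  (+ (x %ℕ S) ℤ.+ x /ℕ S ℤ.* + S) ℤ.- (+ (y %ℕ S) ℤ.+ y /ℕ S ℤ.* + S)
    ≡⟨ cong (λ u → (+ (x %ℕ S) ℤ.+ x /ℕ S ℤ.* + S) ℤ.- (+ u ℤ.+ y /ℕ S ℤ.* + S)) (sym rem) ⟩
  (+ (x %ℕ S) ℤ.+ x /ℕ S ℤ.* + S) ℤ.- (+ (x %ℕ S) ℤ.+ y /ℕ S ℤ.* + S)
    ≡⟨ cancel (+ (x %ℕ S)) (x /ℕ S) (y /ℕ S) (+ S) ⟩
  (x /ℕ S ℤ.- y /ℕ S) ℤ.* + S ∎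
  where
  open ℤSolver.+-*-Solver
  cancel : ∀ r p q s → (r ℤ.+ p ℤ.* s) ℤ.- (r ℤ.+ q ℤ.* s) ≡ (p ℤ.- q) ℤ.* s
  cancel = solve 4 (λ r p q s → (r :+ p :* s) :- (r :+ q :* s) := (p :- q) :* s) refl

%ℕ-unique : ∀ S .{{_ : NonZero S}} X r t → r ℕ.< S →
  X ≡ + r ℤ.+ t ℤ.* + S → X %ℕ S ≡ r
%ℕ-unique S X r t r<S X≡r+tS =
  sym (ℤP.+-injective (close-congruent⇒≡ S (+ r) (+ u) (X /ℕ S ℤ.- t) r-u≡kS lower upper))
  where
  open ℤSolver.+-*-Solver
  u : ℕ
  u = X %ℕ S
  rearrange : ∀ r u q t s → (q ℤ.- t) ℤ.* s ≡ ((u ℤ.+ q ℤ.* s) ℤ.- (r ℤ.+ t ℤ.* s)) ℤ.+ (r ℤ.- u)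
  rearrange = solve 5 (λ r u q t s →
    (q :- t) :* s := ((u :+ q :* s) :- (r :+ t :* s)) :+ (r :- u)) refl
  r-u≡kS : + r ℤ.- + u ≡ (X /ℕ S ℤ.- t) ℤ.* + S
  r-u≡kS = sym (begin
    (X /ℕ S ℤ.- t) ℤ.* + S
      ≡⟨ rearrange (+ r) (+ u) (X /ℕ S) t (+ S) ⟩
    ((+ u ℤ.+ X /ℕ S ℤ.* + S) ℤ.- (+ r ℤ.+ t ℤ.* + S)) ℤ.+ (+ r ℤ.- + u)
      ≡⟨ cong₂ (λ a b → (a ℤ.- b) ℤ.+ (+ r ℤ.- + u)) (sym (ℤD.a≡a%ℕn+[a/ℕn]*n X S)) (sym X≡r+tS) ⟩
    (X ℤ.- X) ℤ.+ (+ r ℤ.- + u)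
      ≡⟨ cong (ℤ._+ (+ r ℤ.- + u)) (ℤP.+-inverseʳ X) ⟩
    0ℤ ℤ.+ (+ r ℤ.- + u)
      ≡⟨ ℤP.+-identityˡ _ ⟩
    + r ℤ.- + u ∎)
  upper : + r ℤ.- + u ℤ.< + S
  upper = ℤP.≤-<-trans (ℤP.i-j≤i (+ r) (+ u)) (ℤ.+<+ r<S)
  lower : ℤ.- (+ S) ℤ.< + r ℤ.- + u
  lower = ℤP.<-≤-trans (ℤP.neg-mono-< (ℤ.+<+ (ℤD.n%ℕd<d X S)))
    (subst (ℤ._≤ + r ℤ.- + u) (ℤP.+-identityˡ (ℤ.- (+ u)))
      (ℤP.+-monoˡ-≤ (ℤ.- (+ u)) (ℤ.+≤+ ℕ.z≤n)))

InUnit : ℚ → Set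
InUnit c = 0ℚ ≤ c × c < 1ℚ

scaled-difference-window : ∀ S .{{_ : Q.Positive S}} {c d} → InUnit c → InUnit d →
  - S < (c - d) * S × (c - d) * S < S
scaled-difference-window S {c} {d} (0≤c , c<1) (0≤d , d<1) = lower , upper
  where
  upper : (c - d) * S < S
  upper = subst ((c - d) * S <_) (QP.*-identityˡ S) (QP.*-monoˡ-<-pos S
    (QP.≤-<-trans (subst (c - d ≤_) (QP.+-identityʳ c) (QP.+-monoʳ-≤ c (QP.neg-antimono-≤ 0≤d))) c<1))
  lower : - S < (c - d) * S
  lower = subst (_< (c - d) * S) (trans (sym (QP.neg-distribˡ-* 1ℚ S)) (cong -_ (QP.*-identityˡ S)))
    (QP.*-monoˡ-<-pos S (QP.<-≤-trans (QP.neg-antimono-< d<1)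
      (subst (_≤ c - d) (QP.+-identityˡ (- d)) (QP.+-monoˡ-≤ (- d) 0≤c))))

unit-from-scaled : ∀ m .{{_ : NonZero m}} c ρ → c * ℕtoℚ m ≡ ℕtoℚ ρ → ρ ℕ.< m → InUnit c
unit-from-scaled m c ρ cm≡ρ ρ<m = nonNeg , below-one
  where
  instance
    m-positive : Q.Positive (ℕtoℚ m)
    m-positive = ℕtoℚ-positive m
  nonNeg : 0ℚ ≤ c
  nonNeg = QP.*-cancelʳ-≤-pos (ℕtoℚ m)
    (subst₂ _≤_ (sym (QP.*-zeroˡ (ℕtoℚ m))) (sym cm≡ρ) (ℤtoℚ-mono-≤ (ℤ.+≤+ {0} {ρ} ℕ.z≤n)))
  below-one : c < 1ℚ
  below-one = QP.*-cancelʳ-<-nonNeg (ℕtoℚ m) {{QP.pos⇒nonNeg (ℕtoℚ m)}}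
    (subst₂ _<_ (sym cm≡ρ) (sym (QP.*-identityˡ (ℕtoℚ m))) (ℤtoℚ-mono-< (ℤ.+<+ ρ<m)))

scale-injective : ∀ S .{{_ : Q.Positive S}} {u v} → u * S ≡ v * S → u ≡ v
scale-injective S uS≡vS = QP.≤-antisym
  (QP.*-cancelʳ-≤-pos S (QP.≤-reflexive uS≡vS))
  (QP.*-cancelʳ-≤-pos S (QP.≤-reflexive (sym uS≡vS)))

-- Uniqueness: x − y = (c − d)·S is a multiple of S lying in (−S, S).
step-injective : ∀ S .{{_ : NonZero S}} a {c d} x y → InUnit c → InUnit d →
  ℤtoℚ x ≡ (a + c) * ℕtoℚ S → ℤtoℚ y ≡ (a + d) * ℕtoℚ S →
  x %ℕ S ≡ y %ℕ S → x ≡ y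
step-injective S a {c} {d} x y c∈ d∈ hx hy rem =
  close-congruent⇒≡ S x y (x /ℕ S ℤ.- y /ℕ S) (same-remainder⇒multiple S x y rem)
    (ℤtoℚ-cancel-< (subst₂ _<_ (sym (ℤtoℚ-neg (+ S))) (sym difference) (proj₁ window)))
    (ℤtoℚ-cancel-< (subst (_< ℕtoℚ S) (sym difference) (proj₂ window)))
  where
  open ℚSolver.+-*-Solver
  instance
    S-positive : Q.Positive (ℕtoℚ S)
    S-positive = ℕtoℚ-positive S
  difference : ℤtoℚ (x ℤ.- y) ≡ (c - d) * ℕtoℚ S
  difference = begin
    ℤtoℚ (x ℤ.- y)                          ≡⟨ ℤtoℚ-- x y ⟩
    ℤtoℚ x - ℤtoℚ y                         ≡⟨ cong₂ _-_ hx hy ⟩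
    (a + c) * ℕtoℚ S - (a + d) * ℕtoℚ S    ≡⟨ solve 4 (λ a c d S →
                                                 (a :+ c) :* S :- (a :+ d) :* S := (c :- d) :* S)
                                                 refl a c d (ℕtoℚ S) ⟩
    (c - d) * ℕtoℚ S                        ∎
  window : - ℕtoℚ S < (c - d) * ℕtoℚ S × (c - d) * ℕtoℚ S < ℕtoℚ S
  window = scaled-difference-window (ℕtoℚ S) c∈ d∈

-- Existence: writing a = p/q, the integer X = r − t·S with
-- t = (r·q − p·S) div (S·q) satisfies q·X − p·S = (r·q − p·S) mod (S·q),
-- so c = X/S − a satisfies c·(S·q) ∈ [0, S·q).
step-exists : ∀ a S .{{_ : NonZero S}} r → r ℕ.< S →
  Σ ℤ λ X → Σ ℚ λ c → InUnit c × ℤtoℚ X ≡ (a + c) * ℕtoℚ S × X %ℕ S ≡ r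
step-exists a S r r<S =
  X , c , unit-from-scaled (S ℕ.* q) c ρ c·Sq≡ρ (ℤD.n%ℕd<d M (S ℕ.* q)) ,
  sym [a+c]S≡X , %ℕ-unique S X r (ℤ.- t) r<S (X-as-remainder (+ r) t (+ S))
  where
  open ℤSolver.+-*-Solver using (solve; _:+_; _:-_; _:*_; :-_; _:=_)
  module ℚS = ℚSolver.+-*-Solver
  p : ℤ
  p = ↥ a
  q : ℕ
  q = ↧ₙ a
  instance
    Sq-nonZero : NonZero (S ℕ.* q)
    Sq-nonZero = ℕP.m*n≢0 S q
    S-positive : Q.Positive (ℕtoℚ S)
    S-positive = ℕtoℚ-positive S
    S-nonZero : Q.NonZero (ℕtoℚ S)
    S-nonZero = QP.pos⇒nonZero (ℕtoℚ S)
  M : ℤ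
  M = + r ℤ.* + q ℤ.- p ℤ.* + S
  t : ℤ
  t = M /ℕ (S ℕ.* q)
  ρ : ℕ
  ρ = M %ℕ (S ℕ.* q)
  X : ℤ
  X = + r ℤ.- t ℤ.* + S
  c : ℚ
  c = ℤtoℚ X * 1/ ℕtoℚ S - a

  X-as-remainder : ∀ r t s → r ℤ.- t ℤ.* s ≡ r ℤ.+ (ℤ.- t) ℤ.* s
  X-as-remainder = solve 3 (λ r t s → r :- t :* s := r :+ (:- t) :* s) refl

  expand : ∀ r q p s t ρ → (r ℤ.- t ℤ.* s) ℤ.* q ℤ.- p ℤ.* s
         ≡ ((r ℤ.* q ℤ.- p ℤ.* s) ℤ.- (ρ ℤ.+ t ℤ.* (s ℤ.* q))) ℤ.+ ρ
  expand = solve 6 (λ r q p s t ρ →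
    (r :- t :* s) :* q :- p :* s := ((r :* q :- p :* s) :- (ρ :+ t :* (s :* q))) :+ ρ) refl

  Xq-pS≡ρ : X ℤ.* + q ℤ.- p ℤ.* + S ≡ + ρ
  Xq-pS≡ρ = begin
    X ℤ.* + q ℤ.- p ℤ.* + S
      ≡⟨ expand (+ r) (+ q) p (+ S) t (+ ρ) ⟩
    (M ℤ.- (+ ρ ℤ.+ t ℤ.* (+ S ℤ.* + q))) ℤ.+ + ρ
      ≡⟨ cong (λ u → (M ℤ.- (+ ρ ℤ.+ t ℤ.* u)) ℤ.+ + ρ) (sym (ℤP.pos-* S q)) ⟩
    (M ℤ.- (+ ρ ℤ.+ t ℤ.* + (S ℕ.* q))) ℤ.+ + ρ
      ≡⟨ cong (λ u → (M ℤ.- u) ℤ.+ + ρ) (sym (ℤD.a≡a%ℕn+[a/ℕn]*n M (S ℕ.* q))) ⟩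
    (M ℤ.- M) ℤ.+ + ρ
      ≡⟨ cong (ℤ._+ + ρ) (ℤP.+-inverseʳ M) ⟩
    0ℤ ℤ.+ + ρ
      ≡⟨ ℤP.+-identityˡ (+ ρ) ⟩
    + ρ ∎

  [a+c]S≡X : (a + c) * ℕtoℚ S ≡ ℤtoℚ X
  [a+c]S≡X = begin
    (a + c) * ℕtoℚ S
      ≡⟨ ℚS.solve 4 (λ a x i s → (a ℚS.:+ (x ℚS.:* i ℚS.:- a)) ℚS.:* s ℚS.:= x ℚS.:* (i ℚS.:* s))
           refl a (ℤtoℚ X) (1/ ℕtoℚ S) (ℕtoℚ S) ⟩
    ℤtoℚ X * (1/ ℕtoℚ S * ℕtoℚ S)
      ≡⟨ cong (ℤtoℚ X *_) (QP.*-inverseˡ (ℕtoℚ S)) ⟩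
    ℤtoℚ X * 1ℚ
      ≡⟨ QP.*-identityʳ (ℤtoℚ X) ⟩
    ℤtoℚ X ∎

  c·Sq≡ρ : c * ℕtoℚ (S ℕ.* q) ≡ ℕtoℚ ρ
  c·Sq≡ρ = begin
    c * ℕtoℚ (S ℕ.* q)
      ≡⟨ cong (c *_) (trans (cong ℤtoℚ (ℤP.pos-* S q)) (ℤtoℚ-* (+ S) (+ q))) ⟩
    c * (ℕtoℚ S * ℕtoℚ q)
      ≡⟨ ℚS.solve 5 (λ x i a s q' →
           (x ℚS.:* i ℚS.:- a) ℚS.:* (s ℚS.:* q')
             ℚS.:= (x ℚS.:* q') ℚS.:* (i ℚS.:* s) ℚS.:- (a ℚS.:* q') ℚS.:* s)
           refl (ℤtoℚ X) (1/ ℕtoℚ S) a (ℕtoℚ S) (ℕtoℚ q) ⟩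
    (ℤtoℚ X * ℕtoℚ q) * (1/ ℕtoℚ S * ℕtoℚ S) - (a * ℕtoℚ q) * ℕtoℚ S
      ≡⟨ cong₂ (λ u v → (ℤtoℚ X * ℕtoℚ q) * u - v * ℕtoℚ S)
           (QP.*-inverseˡ (ℕtoℚ S)) (fraction-form a) ⟩
    (ℤtoℚ X * ℕtoℚ q) * 1ℚ - ℤtoℚ p * ℕtoℚ S
      ≡⟨ cong (_- ℤtoℚ p * ℕtoℚ S) (QP.*-identityʳ (ℤtoℚ X * ℕtoℚ q)) ⟩
    ℤtoℚ X * ℕtoℚ q - ℤtoℚ p * ℕtoℚ S
      ≡⟨ sym (cong₂ _-_ (ℤtoℚ-* X (+ q)) (ℤtoℚ-* p (+ S))) ⟩
    ℤtoℚ (X ℤ.* + q) - ℤtoℚ (p ℤ.* + S)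
      ≡⟨ sym (ℤtoℚ-- (X ℤ.* + q) (p ℤ.* + S)) ⟩
    ℤtoℚ (X ℤ.* + q ℤ.- p ℤ.* + S)
      ≡⟨ cong ℤtoℚ Xq-pS≡ρ ⟩
    ℕtoℚ ρ ∎

sumFin-cong : ∀ {n} {f g : Fin n → ℚ} → (∀ j → f j ≡ g j) → sumFin f ≡ sumFin g
sumFin-cong {zero}  f≡g = refl
sumFin-cong {suc n} f≡g = cong₂ _+_ (f≡g zero) (sumFin-cong (λ j → f≡g (suc j)))

sumFin-zero : ∀ {n} {f : Fin n → ℚ} → (∀ j → f j ≡ 0ℚ) → sumFin f ≡ 0ℚ
sumFin-zero {zero}  f≡0 = refl
sumFin-zero {suc n} f≡0 = cong₂ _+_ (f≡0 zero) (sumFin-zero (λ j → f≡0 (suc j)))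

w-first : ∀ {n} (s : Fin (suc n) → ℕ) i → w s zero i ≡ ℕtoℚ (s i)
w-first {n} s i with zero {n} FinP.≤? i
... | yes _   = refl
... | no  1≰i = ⊥-elim (1≰i ℕ.z≤n)

w-later-head : ∀ {n} (s : Fin (suc n) → ℕ) j → w s (suc j) zero ≡ 0ℚ
w-later-head {n} s j with suc j FinP.≤? zero {n}
... | yes ()
... | no _ = refl

w-later-tail : ∀ {n} (s : Fin (suc n) → ℕ) j i → w s (suc j) (suc i) ≡ w (tail s) j i
w-later-tail s j i with suc j FinP.≤? suc i | j FinP.≤? i
... | yes _           | yes _ = refl
... | no _            | no _  = refl
... | yes (ℕ.s≤s j≤i) | no j≰i = ⊥-elim (j≰i j≤i)
... | no sj≰si        | yes j≤i = ⊥-elim (sj≰si (ℕ.s≤s j≤i))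

combo : ∀ {n} → (Fin n → ℚ) → (Fin n → ℕ) → Fin n → ℚ
combo c s i = sumFin (λ j → c j * w s j i)

combo-head : ∀ {n} (c : Fin (suc n) → ℚ) s → combo c s zero ≡ c zero * ℕtoℚ (s zero)
combo-head c s = begin
  combo c s zero
    ≡⟨ cong₂ _+_ (cong (c zero *_) (w-first s zero))
         (sumFin-zero (λ j → trans (cong (c (suc j) *_) (w-later-head s j)) (QP.*-zeroʳ (c (suc j))))) ⟩
  c zero * ℕtoℚ (s zero) + 0ℚ
    ≡⟨ QP.+-identityʳ _ ⟩
  c zero * ℕtoℚ (s zero) ∎

combo-tail : ∀ {n} (c : Fin (suc n) → ℚ) s i →
  combo c s (suc i) ≡ c zero * ℕtoℚ (s (suc i)) + combo (tail c) (tail s) i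
combo-tail c s i = cong₂ _+_ (cong (c zero *_) (w-first s (suc i)))
  (sumFin-cong (λ j → cong (c (suc j) *_) (w-later-tail s j i)))

ParFrom : ∀ {n} → ℚ → (Fin n → ℕ) → (Fin n → ℤ) → Set
ParFrom {n} a s x = Σ (Fin n → ℚ) λ c → ((j : Fin n) → InUnit (c j)) ×
  ((i : Fin n) → ℤtoℚ (x i) ≡ a * ℕtoℚ (s i) + combo c s i)

offset-zero : ∀ S v → 0ℚ * S + v ≡ v
offset-zero S v = trans (cong (_+ v) (QP.*-zeroˡ S)) (QP.+-identityˡ v)

InPar⇒ParFrom₀ : ∀ {n} (s : Fin n → ℕ) x → InPar s x → ParFrom 0ℚ s x
InPar⇒ParFrom₀ s x (c , c∈ , x≡) =
  c , c∈ , λ i → trans (x≡ i) (sym (offset-zero (ℕtoℚ (s i)) (combo c s i)))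

ParFrom₀⇒InPar : ∀ {n} (s : Fin n → ℕ) x → ParFrom 0ℚ s x → InPar s x
ParFrom₀⇒InPar s x (c , c∈ , x≡) =
  c , c∈ , λ i → trans (x≡ i) (offset-zero (ℕtoℚ (s i)) (combo c s i))

regroup : ∀ a c₀ S T → a * S + (c₀ * S + T) ≡ (a + c₀) * S + T
regroup a c₀ S T = trans (sym (QP.+-assoc (a * S) (c₀ * S) T))
  (cong (_+ T) (sym (QP.*-distribʳ-+ S a c₀)))

ParFrom-uncons : ∀ {n} a (s : Fin (suc n) → ℕ) x → ParFrom a s x →
  Σ ℚ λ c₀ → InUnit c₀ × ℤtoℚ (x zero) ≡ (a + c₀) * ℕtoℚ (s zero) ×
             ParFrom (a + c₀) (tail s) (tail x)
ParFrom-uncons a s x (c , c∈ , x≡) = c zero , c∈ zero , head≡ , (tail c , (c∈ ∘ suc) , tail≡)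
  where
  head≡ : ℤtoℚ (x zero) ≡ (a + c zero) * ℕtoℚ (s zero)
  head≡ = begin
    ℤtoℚ (x zero)                                ≡⟨ x≡ zero ⟩
    a * ℕtoℚ (s zero) + combo c s zero           ≡⟨ cong (_+_ (a * ℕtoℚ (s zero))) (combo-head c s) ⟩
    a * ℕtoℚ (s zero) + c zero * ℕtoℚ (s zero)   ≡⟨ sym (QP.*-distribʳ-+ (ℕtoℚ (s zero)) a (c zero)) ⟩
    (a + c zero) * ℕtoℚ (s zero)                 ∎
  tail≡ : (i : Fin _) → ℤtoℚ (x (suc i)) ≡ (a + c zero) * ℕtoℚ (s (suc i)) + combo (tail c) (tail s) i
  tail≡ i = begin
    ℤtoℚ (x (suc i))
      ≡⟨ x≡ (suc i) ⟩
    a * ℕtoℚ (s (suc i)) + combo c s (suc i)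
      ≡⟨ cong (_+_ (a * ℕtoℚ (s (suc i)))) (combo-tail c s i) ⟩
    a * ℕtoℚ (s (suc i)) + (c zero * ℕtoℚ (s (suc i)) + combo (tail c) (tail s) i)
      ≡⟨ regroup a (c zero) (ℕtoℚ (s (suc i))) _ ⟩
    (a + c zero) * ℕtoℚ (s (suc i)) + combo (tail c) (tail s) i ∎

ParFrom-cons : ∀ {n} a (s : Fin (suc n) → ℕ) {c₀} X xs → InUnit c₀ →
  ℤtoℚ X ≡ (a + c₀) * ℕtoℚ (s zero) → ParFrom (a + c₀) (tail s) xs →
  ParFrom a s (X ∷ xs)
ParFrom-cons a s {c₀} X xs c₀∈ X≡ (cs , cs∈ , xs≡) = c , c∈ , x≡
  where
  c : Fin _ → ℚ
  c = c₀ ∷ cs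
  c∈ : (j : Fin _) → InUnit (c j)
  c∈ zero    = c₀∈
  c∈ (suc j) = cs∈ j
  x≡ : (i : Fin _) → ℤtoℚ ((X ∷ xs) i) ≡ a * ℕtoℚ (s i) + combo c s i
  x≡ zero = begin
    ℤtoℚ X                                ≡⟨ X≡ ⟩
    (a + c₀) * ℕtoℚ (s zero)              ≡⟨ QP.*-distribʳ-+ (ℕtoℚ (s zero)) a c₀ ⟩
    a * ℕtoℚ (s zero) + c₀ * ℕtoℚ (s zero) ≡⟨ cong (_+_ (a * ℕtoℚ (s zero))) (sym (combo-head c s)) ⟩
    a * ℕtoℚ (s zero) + combo c s zero    ∎
  x≡ (suc i) = begin
    ℤtoℚ (xs i)
      ≡⟨ xs≡ i ⟩
    (a + c₀) * ℕtoℚ (s (suc i)) + combo cs (tail s) i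
      ≡⟨ sym (regroup a c₀ (ℕtoℚ (s (suc i))) _) ⟩
    a * ℕtoℚ (s (suc i)) + (c₀ * ℕtoℚ (s (suc i)) + combo cs (tail s) i)
      ≡⟨ cong (_+_ (a * ℕtoℚ (s (suc i)))) (sym (combo-tail c s i)) ⟩
    a * ℕtoℚ (s (suc i)) + combo c s (suc i) ∎

ParFrom-injective : ∀ {n} (s : Fin n → ℕ) (pos : (i : Fin n) → NonZero (s i)) a x y →
  ParFrom a s x → ParFrom a s y →
  ((i : Fin n) → REM s pos x i ≡ REM s pos y i) → (i : Fin n) → x i ≡ y i
ParFrom-injective {zero} s pos a x y px py same-rem ()
ParFrom-injective {suc n} s pos a x y px py same-rem =
  let (c , c∈ , x₀≡ , x-tail) = ParFrom-uncons a s x px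
      (d , d∈ , y₀≡ , y-tail) = ParFrom-uncons a s y py
      x₀≡y₀ : x zero ≡ y zero
      x₀≡y₀ = step-injective (s zero) {{pos zero}} a (x zero) (y zero) c∈ d∈ x₀≡ y₀≡ (same-rem zero)
      same-offset : a + c ≡ a + d
      same-offset = scale-injective (ℕtoℚ (s zero)) {{ℕtoℚ-positive (s zero) {{pos zero}}}}
        (trans (sym x₀≡) (trans (cong ℤtoℚ x₀≡y₀) y₀≡))
      tails-equal : (i : Fin n) → x (suc i) ≡ y (suc i)
      tails-equal = ParFrom-injective (tail s) (pos ∘ suc) (a + c) (tail x) (tail y) x-tail
        (subst (λ b → ParFrom b (tail s) (tail y)) (sym same-offset) y-tail) (same-rem ∘ suc)
  in  λ { zero → x₀≡y₀ ; (suc i) → tails-equal i }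

ParFrom-surjective : ∀ {n} (s : Fin n → ℕ) (pos : (i : Fin n) → NonZero (s i)) a r →
  InΨ s r → Σ (Fin n → ℤ) λ x → ParFrom a s x × ((i : Fin n) → REM s pos x i ≡ r i)
ParFrom-surjective {zero} s pos a r r∈Ψ = (λ ()) , ((λ ()) , (λ ()) , (λ ())) , (λ ())
ParFrom-surjective {suc n} s pos a r r∈Ψ =
  let (X , c , c∈ , X≡ , X-rem) = step-exists a (s zero) {{pos zero}} (r zero) (r∈Ψ zero)
      (xs , xs∈ , xs-rem)       = ParFrom-surjective (tail s) (pos ∘ suc) (a + c) (tail r) (r∈Ψ ∘ suc)
  in  X ∷ xs , ParFrom-cons a s X xs c∈ X≡ xs∈ , λ { zero → X-rem ; (suc i) → xs-rem i }

lemma3p2 : (n : ℕ) (s : Fin n → ℕ) (pos : (i : Fin n) → NonZero (s i)) →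
    ((x : Fin n → ℤ) → InPar s x → InΨ s (REM s pos x)) ×
    ((x y : Fin n → ℤ) → InPar s x → InPar s y →
      ((i : Fin n) → REM s pos x i ≡ REM s pos y i) → (i : Fin n) → x i ≡ y i) ×
    ((r : Fin n → ℕ) → InΨ s r →
      Σ (Fin n → ℤ) λ x → InPar s x × ((i : Fin n) → REM s pos x i ≡ r i))
lemma3p2 n s pos =
  (λ x _ i → ℤD.n%ℕd<d (x i) (s i) {{pos i}}) ,
  (λ x y x∈Par y∈Par →
    ParFrom-injective s pos 0ℚ x y (InPar⇒ParFrom₀ s x x∈Par) (InPar⇒ParFrom₀ s y y∈Par)) ,
  λ r r∈Ψ → let (x , x∈Par , x-rem) = ParFrom-surjective s pos 0ℚ r r∈Ψ
            in x , ParFrom₀⇒InPar s x x∈Par , x-rem
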